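{- Let $q$ be a prime and let $\{V_{q-1}+l : l\in\mathcal{L}\}$ be a tiling of $\mathbb{Z}^{q-1}$ by translates of the semi-cross $V_{q-1}=\{\mathbf{0},\mathbf{e}_1,\dots,\mathbf{e}_{q-1}\}$. Let $W\in\mathcal{L}$ and let $a$ be an integer with $1\le a\le q-1$. Then there is no $Z\in\mathcal{L}$ such that $Z-W$ has exactly one nonzero coordinate and it equals $a$, and there is no $Z\in\mathcal{L}$ such that $Z-W$ has exactly two nonzero coordinates, one equal to $a$ and the other equal to $-a$.
   Context: A tiling of $\mathbb{Z}^{m}$ by translates of $V$ is a family $\{V+l: l\in\mathcal{L}\}$ such that every $x\in\mathbb{Z}^m$ can be written uniquely as $x=v+l$ with $v\in V$, $l\in\mathcal{L}$. $\mathbf{e}_i$ is the $i$-th standard basis vector. -}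

module Defs where

open import Data.Nat using (ℕ)
open import Data.Integer using (ℤ; +_; _+_; _-_)
open import Data.Fin using (Fin; _≟_)
open import Data.Vec using (Vec; replicate; tabulate; zipWith; lookup)
open import Data.Product using (Σ; ∃; ∃-syntax; _×_; _,_)
open import Data.Sum using (_⊎_)
open import Relation.Binary.PropositionalEquality using (_≡_; _≢_)
open import Relation.Nullary using (yes; no)

Point : ℕ → Set
Point m = Vec ℤ m

𝟎 : ∀ {m} → Point m
𝟎 = replicate _ (+ 0)

e : ∀ {m} → Fin m → Point m
e i = tabulate λ j → case-eq j
  where
  case-eq : _ → ℤ
  case-eq j with i ≟ j
  ... | yes _ = + 1
  ... | no _  = + 0

_⊕_ : ∀ {m} → Point m → Point m → Point m
_⊕_ = zipWith _+_

_⊖_ : ∀ {m} → Point m → Point m → Point m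
_⊖_ = zipWith _-_

SemiCross : ∀ m → Point m → Set
SemiCross m v = (v ≡ 𝟎) ⊎ (∃[ i ] v ≡ e i)

IsTiling : ∀ m → (V : Point m → Set) → (L : Point m → Set) → Set
IsTiling m V L =
  (∀ x → ∃[ v ] ∃[ l ] (V v × L l × x ≡ v ⊕ l)) ×
  (∀ x v l v′ l′ → V v → L l → x ≡ v ⊕ l → V v′ → L l′ → x ≡ v′ ⊕ l′ →
     (v ≡ v′ × l ≡ l′))

OneNonzero : ∀ {m} → Point m → ℤ → Set
OneNonzero d c = ∃[ i ] (lookup d i ≡ c × (∀ j → j ≢ i → lookup d j ≡ + 0))

TwoNonzero : ∀ {m} → Point m → ℤ → ℤ → Set
TwoNonzero d c c′ = ∃[ i ] ∃[ j ] (i ≢ j × lookup d i ≡ c × lookup d j ≡ c′ ×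
  (∀ k → k ≢ i → k ≢ j → lookup d k ≡ + 0))

-- Let f be the indicator function of L and A_t g (x) = Σ_{v ∈ V} g (x - t v), so that L tiles with
-- V exactly when A_1 f = 1.  The translations commute, so the freshman's dream gives
-- A_t ^ p ≡ A_{p t} modulo p for every prime p.  If A_t f = 1 then A_t ^ p f = q ^ (p - 1), hence
-- A_{p t} f is never 0 when p ∤ q; as A_1 (A_{p t} f) = A_{p t} (A_1 f) = q is a sum of q such
-- values, A_{p t} f = 1.  Multiplying prime by prime, A_a f = 1 for 1 ≤ a < q: L also tiles with
-- the dilate a V.  But if Z - W = a e_i then Z = 0 + Z = a e_i + W is covered twice by a V + L,
-- and if Z - W = a e_i - a e_j then so is Z + a e_j = a e_j + Z = a e_i + W.

module Submission where

open import Algebra.Bundles using (Semiring)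
open import Data.Bool using (if_then_else_)
open import Data.Fin using (Fin; zero; suc; toℕ; fromℕ; inject₁; _≟_)
open import Data.Fin.Properties using (toℕ-fromℕ; toℕ-inject₁; toℕ<n; suc-injective; 0≢1+n)
open import Data.Integer as ℤ using (+_; -_)
import Data.Integer.Properties as ℤ
open import Data.Integer.Tactic.RingSolver using () renaming (solve-∀ to solveℤ)
open import Data.List using (_∷_)
open import Data.List.Relation.Unary.All using (All; _∷_; [])
open import Data.Nat as ℕ using (ℕ; zero; suc; _∸_; _≤_; _<_; s≤s; z≤n)
import Data.Nat.Properties as ℕ
open import Data.Nat.Combinatorics using (_C_; nC1≡n; nCn≡1; nCk+nC[k+1]≡[n+1]C[k+1])
open import Data.Nat.Divisibility using (_∣_; divides; quotient; m∣m*n; ∣⇒≤; ∣1⇒≡1; hasNonTrivialDivisor)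
open import Data.Nat.ListAction using (product)
open import Data.Nat.Primality
  using (Prime; euclidsLemma; prime⇒nonTrivial; prime⇒nonZero; productOfPrimes≢0)
open import Data.Nat.Primality.Factorisation using (PrimeFactorisation; factorise)
open import Data.Nat.Tactic.RingSolver using (solve-∀)
open import Data.Product using (∃-syntax; _,_; proj₁; proj₂)
open import Data.Sum using (inj₁; inj₂)
open import Data.Vec using (lookup; _[_]%=_)
open import Data.Vec.Functional using (Vector; init; tail)
open import Data.Vec.Properties
  using (lookup∘tabulate; lookup-zipWith; lookup-replicate; lookup∘updateAt; lookup∘updateAt′;
         updateAt-id; updateAt-id-local; updateAt-updateAt-local; updateAt-commutes)
open import Data.Vec.Relation.Binary.Pointwise.Extensional using (ext; Pointwise-≡⇒≡)
open import Function using (_∘_; _∋_)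
open import Relation.Binary.PropositionalEquality as ≡ using (_≡_; _≢_; _≗_; cong; subst)
open import Relation.Nullary using (¬_; yes; no; does)
open import Relation.Nullary.Decidable using (dec-true; dec-false)
open import Relation.Nullary.Negation using (contradiction)
open import Relation.Unary using (Decidable)

[1+k]*[1+n]C[1+k]≡[1+n]*nCk : ∀ n k → suc k ℕ.* (suc n C suc k) ≡ suc n ℕ.* (n C k)
[1+k]*[1+n]C[1+k]≡[1+n]*nCk zero    zero    = ≡.refl
[1+k]*[1+n]C[1+k]≡[1+n]*nCk zero    (suc k) = ℕ.*-zeroʳ (suc (suc k))
[1+k]*[1+n]C[1+k]≡[1+n]*nCk (suc n) zero    =
  ≡.trans (ℕ.+-identityʳ _) (≡.trans (nC1≡n (suc (suc n))) (≡.sym (ℕ.*-identityʳ _)))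
[1+k]*[1+n]C[1+k]≡[1+n]*nCk (suc n) (suc k) = begin
  suc (suc k) ℕ.* (suc (suc n) C suc (suc k))
    ≡⟨ cong (suc (suc k) ℕ.*_) (nCk+nC[k+1]≡[n+1]C[k+1] (suc n) (suc k)) ⟨
  suc (suc k) ℕ.* (a ℕ.+ b)
    ≡⟨ distribute a b k ⟩
  a ℕ.+ (suc k ℕ.* a ℕ.+ suc (suc k) ℕ.* b)
    ≡⟨ cong (a ℕ.+_) (≡.cong₂ ℕ._+_ ([1+k]*[1+n]C[1+k]≡[1+n]*nCk n k) ([1+k]*[1+n]C[1+k]≡[1+n]*nCk n (suc k))) ⟩
  a ℕ.+ (suc n ℕ.* (n C k) ℕ.+ suc n ℕ.* (n C suc k))
    ≡⟨ cong (a ℕ.+_) (ℕ.*-distribˡ-+ (suc n) (n C k) (n C suc k)) ⟨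
  a ℕ.+ suc n ℕ.* (n C k ℕ.+ n C suc k)
    ≡⟨ cong (λ c → a ℕ.+ suc n ℕ.* c) (nCk+nC[k+1]≡[n+1]C[k+1] n k) ⟩
  a ℕ.+ suc n ℕ.* a
    ∎
  where
  open ≡.≡-Reasoning
  a = suc n C suc k
  b = suc n C suc (suc k)
  distribute : ∀ a b k → suc (suc k) ℕ.* (a ℕ.+ b) ≡ a ℕ.+ (suc k ℕ.* a ℕ.+ suc (suc k) ℕ.* b)
  distribute = solve-∀

prime∣pCk : ∀ {p k} → Prime p → 0 < k → k < p → p ∣ p C k
prime∣pCk {suc n} {suc k} pr _ k<p
  with euclidsLemma (suc k) (suc n C suc k) pr
         (subst (suc n ∣_) (≡.sym ([1+k]*[1+n]C[1+k]≡[1+n]*nCk n k)) (m∣m*n (n C k)))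
... | inj₁ p∣1+k = contradiction (∣⇒≤ p∣1+k) (ℕ.<⇒≱ k<p)
... | inj₂ p∣pCk = p∣pCk

prime∣^⇒∣ : ∀ {p m} n → Prime p → p ∣ m ℕ.^ n → p ∣ m
prime∣^⇒∣ zero pr p∣1 = contradiction (∣1⇒≡1 p∣1) (ℕ.nonTrivial⇒≢1 {{prime⇒nonTrivial pr}})
prime∣^⇒∣ {m = m} (suc n) pr p∣m^[1+n] with euclidsLemma m (m ℕ.^ n) pr p∣m^[1+n]
... | inj₁ p∣m   = p∣m
... | inj₂ p∣m^n = prime∣^⇒∣ n pr p∣m^n

prime∤prime : ∀ {p q} → Prime p → Prime q → p < q → ¬ p ∣ q
prime∤prime p-prime q-prime p<q p∣q =
  Prime.notComposite q-prime (hasNonTrivialDivisor {{prime⇒nonTrivial p-prime}} p<q p∣q)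

module _ {c ℓ} (S : Semiring c ℓ) where

  open Semiring S hiding (zero)
  open import Algebra.Properties.Semiring.Exp S using (_^_)
  open import Algebra.Properties.Semiring.Mult S using (_×_; ×-congˡ; ×-assocˡ; ×-homo-1)
  open import Algebra.Properties.CommutativeMonoid.Mult +-commutativeMonoid using (×-distrib-+)
  open import Algebra.Properties.Semiring.Sum S
    using (sum; sum-cong-≋; sum-init-last; sum-replicate; sum-replicate-zero; *-distribˡ-sum; *-distribʳ-sum)
  import Algebra.Properties.Semiring.Binomial S as Binomial
  open import Algebra.Solver.CommutativeMonoid +-commutativeMonoid using (solve; _⊕_; _⊜_)
  open import Relation.Binary.Reasoning.Setoid setoid

  ×-zeroʳ : ∀ n → n × 0# ≈ 0#
  ×-zeroʳ n = trans (sym (sum-replicate n)) (sum-replicate-zero n)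

  ×-distrib-sum : ∀ {k} n (xs : Vector Carrier k) → n × sum xs ≈ sum (λ i → n × xs i)
  ×-distrib-sum {zero}  n xs = ×-zeroʳ n
  ×-distrib-sum {suc k} n xs = trans (×-distrib-+ (xs zero) (sum (tail xs)) n) (+-congˡ (×-distrib-sum n (tail xs)))

  *-comm-sum : ∀ {n} x (ys : Vector Carrier n) → (∀ i → x * ys i ≈ ys i * x) → x * sum ys ≈ sum ys * x
  *-comm-sum x ys x*y≈y*x = begin
    x * sum ys            ≈⟨ *-distribˡ-sum x ys ⟩
    sum (λ i → x * ys i)  ≈⟨ sum-cong-≋ x*y≈y*x ⟩
    sum (λ i → ys i * x)  ≈⟨ *-distribʳ-sum x ys ⟨
    sum ys * x            ∎

  -- All inner binomial coefficients of a prime p are multiples of p.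
  binomial-mod-prime : ∀ {x y} → x * y ≈ y * x → ∀ {p} → Prime p →
                       ∃[ r ] (x + y) ^ p ≈ x ^ p + y ^ p + p × r
  binomial-mod-prime {x} {y} xy≈yx {suc n} pr = sum r , (begin
    (x + y) ^ p                                ≈⟨ Binomial.theorem x y xy≈yx p ⟩
    term zero + sum (tail term)                ≈⟨ +-congˡ (sum-init-last (tail term)) ⟩
    term zero + (sum inner + term (fromℕ p))   ≈⟨ +-cong first (+-cong (sum-cong-≋ inner≈p×r) last) ⟩
    y ^ p + (sum (λ k → p × r k) + x ^ p)      ≈⟨ +-congˡ (+-congʳ (×-distrib-sum p r)) ⟨
    y ^ p + (p × sum r + x ^ p)                ≈⟨ solve 3 (λ a b c → a ⊕ (b ⊕ c) ⊜ (c ⊕ a) ⊕ b) refl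
                                                    (y ^ p) (p × sum r) (x ^ p) ⟩
    x ^ p + y ^ p + p × sum r                  ∎)
    where
    p = suc n
    term = Binomial.binomialTerm x y p
    inner : Vector Carrier n
    inner = init (tail term)
    p∣pCk : ∀ (k : Fin n) → p ∣ p C suc (toℕ (inject₁ k))
    p∣pCk k = prime∣pCk pr (s≤s z≤n) (s≤s (subst (_< n) (≡.sym (toℕ-inject₁ k)) (toℕ<n k)))
    r : Vector Carrier n
    r k = quotient (p∣pCk k) × Binomial.binomial x y p (suc (inject₁ k))
    inner≈p×r : ∀ k → inner k ≈ p × r k
    inner≈p×r k = begin
      (p C suc (toℕ (inject₁ k))) × b  ≈⟨ ×-congˡ (≡.trans (_∣_.equality (p∣pCk k)) (ℕ.*-comm (quotient (p∣pCk k)) p)) ⟩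
      (p ℕ.* quotient (p∣pCk k)) × b   ≈⟨ ×-assocˡ b p (quotient (p∣pCk k)) ⟨
      p × r k                          ∎
      where b = Binomial.binomial x y p (suc (inject₁ k))
    first : term zero ≈ y ^ p
    first = trans (×-homo-1 _) (*-identityˡ _)
    last : term (fromℕ p) ≈ x ^ p
    last = begin
      (p C toℕ (fromℕ p)) × (x ^ toℕ (fromℕ p) * y ^ (p ∸ toℕ (fromℕ p)))
        ≡⟨ cong (λ k → (p C k) × (x ^ k * y ^ (p ∸ k))) (toℕ-fromℕ p) ⟩
      (p C p) × (x ^ p * y ^ (p ∸ p))  ≡⟨ ≡.cong₂ (λ c k → c × (x ^ p * y ^ k)) (nCn≡1 p) (ℕ.n∸n≡0 p) ⟩
      1 × (x ^ p * 1#)                 ≈⟨ ×-homo-1 _ ⟩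
      x ^ p * 1#                       ≈⟨ *-identityʳ _ ⟩
      x ^ p                            ∎

  sum-^-mod-prime : ∀ {n} (xs : Vector Carrier n) → (∀ i j → xs i * xs j ≈ xs j * xs i) →
                    ∀ {p} → Prime p → ∃[ r ] sum xs ^ p ≈ sum (λ i → xs i ^ p) + p × r
  sum-^-mod-prime {zero} xs _ {suc n} _ =
    0# , trans (zeroˡ _) (sym (trans (+-identityˡ _) (×-zeroʳ (suc n))))
  sum-^-mod-prime {suc n} xs comm {p} pr
    with binomial-mod-prime (*-comm-sum (xs zero) (tail xs) (comm zero ∘ suc)) pr
       | sum-^-mod-prime (tail xs) (λ i j → comm (suc i) (suc j)) pr
  ... | r₁ , eq₁ | r₂ , eq₂ = r₁ + r₂ , (begin
    (x + s) ^ p                      ≈⟨ eq₁ ⟩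
    x ^ p + s ^ p + p × r₁           ≈⟨ +-congʳ (+-congˡ eq₂) ⟩
    x ^ p + (sᵖ + p × r₂) + p × r₁   ≈⟨ solve 4 (λ a b c d → (a ⊕ (b ⊕ c)) ⊕ d ⊜ (a ⊕ b) ⊕ (d ⊕ c)) refl
                                          (x ^ p) sᵖ (p × r₂) (p × r₁) ⟩
    x ^ p + sᵖ + (p × r₁ + p × r₂)   ≈⟨ +-congˡ (×-distrib-+ r₁ r₂ p) ⟨
    x ^ p + sᵖ + p × (r₁ + r₂)       ∎)
    where
    x = xs zero
    s = sum (tail xs)
    sᵖ = sum (λ i → tail xs i ^ p)

open import Algebra.Properties.CommutativeMonoid.Sum ℕ.+-0-commutativeMonoid using (sum; sum-cong-≗; ∑-comm)

sum-const : ∀ n c → sum {n} (λ _ → c) ≡ n ℕ.* c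
sum-const zero    c = ≡.refl
sum-const (suc n) c = cong (c ℕ.+_) (sum-const n c)

single-one⇒sum≡1 : ∀ {n} (u : Vector ℕ n) k → u k ≡ 1 → (∀ i → i ≢ k → u i ≡ 0) → sum u ≡ 1
single-one⇒sum≡1 {suc n} u zero    uₖ≡1 u≡0 =
  ≡.cong₂ ℕ._+_ uₖ≡1 (≡.trans (sum-cong-≗ (λ i → u≡0 (suc i) λ ())) (≡.trans (sum-const n 0) (ℕ.*-zeroʳ n)))
single-one⇒sum≡1 {suc n} u (suc k) uₖ≡1 u≡0 =
  ≡.cong₂ ℕ._+_ (u≡0 zero λ ()) (single-one⇒sum≡1 (tail u) k uₖ≡1 (λ i i≢k → u≡0 (suc i) (i≢k ∘ suc-injective)))

≤-sum : ∀ {n} (u : Vector ℕ n) i → u i ≤ sum u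
≤-sum u zero    = ℕ.m≤m+n (u zero) (sum (tail u))
≤-sum u (suc i) = ℕ.≤-trans (≤-sum (tail u) i) (ℕ.m≤n+m _ (u zero))

+-≤-sum : ∀ {n} (u : Vector ℕ n) {i j} → i ≢ j → u i ℕ.+ u j ≤ sum u
+-≤-sum u {zero}  {zero}  0≢0 = contradiction ≡.refl 0≢0
+-≤-sum u {zero}  {suc j} _   = ℕ.+-monoʳ-≤ (u zero) (≤-sum (tail u) j)
+-≤-sum u {suc i} {zero}  _   =
  ℕ.≤-trans (ℕ.≤-reflexive (ℕ.+-comm (u (suc i)) (u zero))) (ℕ.+-monoʳ-≤ (u zero) (≤-sum (tail u) i))
+-≤-sum u {suc i} {suc j} i≢j = ℕ.≤-trans (+-≤-sum (tail u) (i≢j ∘ cong suc)) (ℕ.m≤n+m _ (u zero))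

length≤sum : ∀ {n} (u : Vector ℕ n) → (∀ i → 1 ≤ u i) → n ≤ sum u
length≤sum {zero}  u _   = z≤n
length≤sum {suc n} u 1≤u = ℕ.+-mono-≤ (1≤u zero) (length≤sum (tail u) (1≤u ∘ suc))

sum≡length⇒≡1 : ∀ {n} (u : Vector ℕ n) → (∀ i → 1 ≤ u i) → sum u ≡ n → ∀ i → u i ≡ 1
sum≡length⇒≡1 {suc n} u 1≤u Σu≡1+n = λ
  { zero    → u₀≡1
  ; (suc i) → sum≡length⇒≡1 (tail u) (1≤u ∘ suc) Σtail≡n i
  }
  where
  u₀≡1 : u zero ≡ 1
  u₀≡1 = ℕ.≤-antisym
    (ℕ.+-cancelʳ-≤ n (u zero) 1
      (ℕ.≤-trans (ℕ.+-monoʳ-≤ (u zero) (length≤sum (tail u) (1≤u ∘ suc))) (ℕ.≤-reflexive Σu≡1+n)))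
    (1≤u zero)
  Σtail≡n : sum (tail u) ≡ n
  Σtail≡n = ℕ.+-cancelˡ-≡ 1 _ _ (≡.trans (cong (ℕ._+ sum (tail u)) (≡.sym u₀≡1)) Σu≡1+n)

-- Without function extensionality operators are compared pointwise, so congruence is a field.
module AdditiveOperators (P : Set) where

  open import Algebra.Structures using (IsSemiring)
  open import Algebra.Properties.CommutativeSemigroup ℕ.+-commutativeSemigroup
    using () renaming (interchange to +-interchange)

  record Operator : Set where
    field
      apply      : (P → ℕ) → P → ℕ
      apply-cong : ∀ {g h} → g ≗ h → apply g ≗ apply h
      apply-+    : ∀ g h x → apply (λ y → g y ℕ.+ h y) x ≡ apply g x ℕ.+ apply h x
      apply-0    : ∀ x → apply (λ _ → 0) x ≡ 0

  open Operator public

  infix 4 _≈_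
  _≈_ : Operator → Operator → Set
  X ≈ Y = ∀ g → apply X g ≗ apply Y g

  infixl 6 _+_
  _+_ : Operator → Operator → Operator
  X + Y = record
    { apply      = λ g x → apply X g x ℕ.+ apply Y g x
    ; apply-cong = λ g≗h x → ≡.cong₂ ℕ._+_ (apply-cong X g≗h x) (apply-cong Y g≗h x)
    ; apply-+    = λ g h x → ≡.trans (≡.cong₂ ℕ._+_ (apply-+ X g h x) (apply-+ Y g h x))
                                     (+-interchange (apply X g x) (apply X h x) (apply Y g x) (apply Y h x))
    ; apply-0    = λ x → ≡.cong₂ ℕ._+_ (apply-0 X x) (apply-0 Y x)
    }

  infixl 7 _*_
  _*_ : Operator → Operator → Operator
  X * Y = record
    { apply      = λ g → apply X (apply Y g)
    ; apply-cong = λ g≗h → apply-cong X (apply-cong Y g≗h)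
    ; apply-+    = λ g h x → ≡.trans (apply-cong X (apply-+ Y g h) x) (apply-+ X _ _ x)
    ; apply-0    = λ x → ≡.trans (apply-cong X (apply-0 Y) x) (apply-0 X x)
    }

  0# : Operator
  0# = record { apply = λ _ _ → 0 ; apply-cong = λ _ _ → ≡.refl ; apply-+ = λ _ _ _ → ≡.refl ; apply-0 = λ _ → ≡.refl }

  1# : Operator
  1# = record { apply = λ g → g ; apply-cong = λ g≗h → g≗h ; apply-+ = λ _ _ _ → ≡.refl ; apply-0 = λ _ → ≡.refl }

  isSemiring : IsSemiring _≈_ _+_ _*_ 0# 1#
  isSemiring = record
    { isSemiringWithoutAnnihilatingZero = record
      { +-isCommutativeMonoid = record
        { isMonoid = record
          { isSemigroup = record
            { isMagma = record
              { isEquivalence = record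
                { refl  = λ _ _ → ≡.refl
                ; sym   = λ X≈Y g x → ≡.sym (X≈Y g x)
                ; trans = λ X≈Y Y≈Z g x → ≡.trans (X≈Y g x) (Y≈Z g x)
                }
              ; ∙-cong = λ X≈X′ Y≈Y′ g x → ≡.cong₂ ℕ._+_ (X≈X′ g x) (Y≈Y′ g x)
              }
            ; assoc = λ X Y Z g x → ℕ.+-assoc (apply X g x) (apply Y g x) (apply Z g x)
            }
          ; identity = (λ _ _ _ → ≡.refl) , (λ X g x → ℕ.+-identityʳ (apply X g x))
          }
        ; comm = λ X Y g x → ℕ.+-comm (apply X g x) (apply Y g x)
        }
      ; *-cong     = λ {X} {_} {_} {Y′} X≈X′ Y≈Y′ g x → ≡.trans (apply-cong X (Y≈Y′ g) x) (X≈X′ (apply Y′ g) x)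
      ; *-assoc    = λ _ _ _ _ _ → ≡.refl
      ; *-identity = (λ _ _ _ → ≡.refl) , (λ _ _ _ → ≡.refl)
      ; distrib    = (λ X _ _ _ x → apply-+ X _ _ x) , (λ _ _ _ _ _ → ≡.refl)
      }
    ; zero = (λ _ _ _ → ≡.refl) , (λ X _ x → apply-0 X x)
    }

  semiring : Semiring _ _
  semiring = record { isSemiring = isSemiring }

  open import Algebra.Properties.Semiring.Mult semiring using (_×_)
  open import Algebra.Properties.Semiring.Exp semiring public using (_^_)
  open import Algebra.Properties.Semiring.Sum semiring public using () renaming (sum to sumᵒ)

  apply-sum : ∀ {n} (Xs : Vector Operator n) g x → apply (sumᵒ Xs) g x ≡ sum (λ i → apply (Xs i) g x)
  apply-sum {zero}  Xs g x = ≡.refl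
  apply-sum {suc n} Xs g x = cong (apply (Xs zero) g x ℕ.+_) (apply-sum (tail Xs) g x)

  apply-× : ∀ n X g x → apply (n × X) g x ≡ n ℕ.* apply X g x
  apply-× zero    X g x = ≡.refl
  apply-× (suc n) X g x = cong (apply X g x ℕ.+_) (apply-× n X g x)

  sumᵒ-^-mod-prime : ∀ {n} (Xs : Vector Operator n) → (∀ i j → Xs i * Xs j ≈ Xs j * Xs i) →
                     ∀ {p} → Prime p → ∀ g x →
                     ∃[ c ] apply (sumᵒ Xs ^ p) g x ≡ sum (λ i → apply (Xs i ^ p) g x) ℕ.+ p ℕ.* c
  sumᵒ-^-mod-prime Xs comm {p} pr g x =
    let r , Σᵖ≈ = sum-^-mod-prime semiring Xs comm pr in
    apply r g x ,
    ≡.trans (Σᵖ≈ g x) (≡.cong₂ ℕ._+_ (apply-sum (λ i → Xs i ^ p) g x) (apply-× p r g x))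

open import Defs
open import Data.Product using (_×_)

[z-u]-v≡z-[u+v] : ∀ z u v → z ℤ.- u ℤ.- v ≡ z ℤ.- (u ℤ.+ v)
[z-u]-v≡z-[u+v] = solveℤ

[z-u]-v≡[z-v]-u : ∀ z u v → z ℤ.- u ℤ.- v ≡ z ℤ.- v ℤ.- u
[z-u]-v≡[z-v]-u = solveℤ

u+[z-u]≡z : ∀ u z → u ℤ.+ (z ℤ.- u) ≡ z
u+[z-u]≡z = solveℤ

[u+z]-u≡z : ∀ u z → u ℤ.+ z ℤ.- u ≡ z
[u+z]-u≡z = solveℤ

[z+u]-u≡z : ∀ z u → z ℤ.+ u ℤ.- u ≡ z
[z+u]-u≡z = solveℤ

z-[z-w]≡w : ∀ z w → z ℤ.- (z ℤ.- w) ≡ w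
z-[z-w]≡w = solveℤ

-- The coordinates of e i only compute once i ≟ j has been abstracted in the type of
-- lookup∘tabulate.
lookup-e-≡ : ∀ {m} (i : Fin m) → lookup (e i) i ≡ + 1
lookup-e-≡ i with i ≟ i | (lookup (e i) i ≡ _ ∋ lookup∘tabulate _ i)
... | yes _  | eq = eq
... | no i≢i | _  = contradiction ≡.refl i≢i

lookup-e-≢ : ∀ {m} {i j : Fin m} → i ≢ j → lookup (e i) j ≡ + 0
lookup-e-≢ {i = i} {j} i≢j with i ≟ j | (lookup (e i) j ≡ _ ∋ lookup∘tabulate _ j)
... | yes i≡j | _  = contradiction i≡j i≢j
... | no _    | eq = eq

module Translations (m : ℕ) where

  ≡-pointwise : ∀ {x y : Point m} → (∀ j → lookup x j ≡ lookup y j) → x ≡ y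
  ≡-pointwise x≗y = Pointwise-≡⇒≡ (ext x≗y)

  lookup-⊕ : ∀ (x y : Point m) j → lookup (x ⊕ y) j ≡ lookup x j ℤ.+ lookup y j
  lookup-⊕ x y j = lookup-zipWith ℤ._+_ j x y

  lookup-⊖ : ∀ (z w : Point m) j {c} → lookup (z ⊖ w) j ≡ c → lookup w j ≡ lookup z j ℤ.- c
  lookup-⊖ z w j {c} z-w≡c = ≡.trans (≡.sym (z-[z-w]≡w (lookup z j) (lookup w j)))
    (cong (λ d → lookup z j ℤ.- d) (≡.trans (≡.sym (lookup-zipWith ℤ._-_ j z w)) z-w≡c))

  𝟎⊕ : ∀ x → 𝟎 ⊕ x ≡ x
  𝟎⊕ x = ≡-pointwise λ j → ≡.trans (lookup-⊕ 𝟎 x j)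
    (≡.trans (cong (ℤ._+ lookup x j) (lookup-replicate j (+ 0))) (ℤ.+-identityˡ (lookup x j)))

  e≢𝟎 : ∀ (i : Fin m) → e i ≢ 𝟎
  e≢𝟎 i eᵢ≡𝟎 with ≡.trans (≡.sym (lookup-e-≡ i)) (≡.trans (cong (λ v → lookup v i) eᵢ≡𝟎) (lookup-replicate i (+ 0)))
  ... | ()

  e-injective : ∀ {i j : Fin m} → e i ≡ e j → i ≡ j
  e-injective {i} {j} eᵢ≡eⱼ with i ≟ j
  ... | yes i≡j = i≡j
  ... | no i≢j with ≡.trans (≡.sym (lookup-e-≢ i≢j)) (≡.trans (cong (λ v → lookup v j) eᵢ≡eⱼ) (lookup-e-≡ j))
  ... | ()

  shift : ℕ → Fin m → Point m → Point m
  shift t i x = x [ i ]%= (ℤ._- + t)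

  shift-0 : ∀ i x → shift 0 i x ≡ x
  shift-0 i x = updateAt-id-local i x (ℤ.+-identityʳ (lookup x i))

  shift-shift : ∀ s t i x → shift s i (shift t i x) ≡ shift (t ℕ.+ s) i x
  shift-shift s t i x = updateAt-updateAt-local i x (begin
    z ℤ.- + t ℤ.- + s    ≡⟨ [z-u]-v≡z-[u+v] z (+ t) (+ s) ⟩
    z ℤ.- (+ t ℤ.+ + s)  ≡⟨ cong (λ w → z ℤ.- w) (ℤ.pos-+ t s) ⟨
    z ℤ.- + (t ℕ.+ s)    ∎)
    where
    open ≡.≡-Reasoning
    z = lookup x i

  shift-comm : ∀ s i t j x → shift s i (shift t j x) ≡ shift t j (shift s i x)
  shift-comm s i t j x with i ≟ j
  ... | no i≢j     = updateAt-commutes i j i≢j x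
  ... | yes ≡.refl =
    ≡.trans (updateAt-updateAt-local i {h = λ z → z ℤ.- + s ℤ.- + t} x ([z-u]-v≡[z-v]-u (lookup x i) (+ t) (+ s)))
            (≡.sym (updateAt-updateAt-local i x ≡.refl))

  vertex : Fin (suc m) → Point m
  vertex zero    = 𝟎
  vertex (suc i) = e i

  vertex-injective : ∀ {k l} → vertex k ≡ vertex l → k ≡ l
  vertex-injective {zero}  {zero}  _     = ≡.refl
  vertex-injective {zero}  {suc j} 𝟎≡eⱼ  = contradiction (≡.sym 𝟎≡eⱼ) (e≢𝟎 j)
  vertex-injective {suc i} {zero}  eᵢ≡𝟎  = contradiction eᵢ≡𝟎 (e≢𝟎 i)
  vertex-injective {suc i} {suc j} eᵢ≡eⱼ = cong suc (e-injective eᵢ≡eⱼ)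

  semiCross⇒vertex : ∀ {v} → SemiCross m v → ∃[ k ] v ≡ vertex k
  semiCross⇒vertex (inj₁ v≡𝟎)        = zero , v≡𝟎
  semiCross⇒vertex (inj₂ (i , v≡eᵢ)) = suc i , v≡eᵢ

  vertex∈semiCross : ∀ k → SemiCross m (vertex k)
  vertex∈semiCross zero    = inj₁ ≡.refl
  vertex∈semiCross (suc i) = inj₂ (i , ≡.refl)

  translate : ℕ → Fin (suc m) → Point m → Point m
  translate t zero    x = x
  translate t (suc i) x = shift t i x

  translate-0 : ∀ k x → translate 0 k x ≡ x
  translate-0 zero    x = ≡.refl
  translate-0 (suc i) x = shift-0 i x

  translate-translate : ∀ s t k x → translate s k (translate t k x) ≡ translate (t ℕ.+ s) k x
  translate-translate s t zero    x = ≡.refl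
  translate-translate s t (suc i) x = shift-shift s t i x

  translate-comm : ∀ s k t l x → translate s k (translate t l x) ≡ translate t l (translate s k x)
  translate-comm s zero    t l       x = ≡.refl
  translate-comm s (suc i) t zero    x = ≡.refl
  translate-comm s (suc i) t (suc j) x = shift-comm s i t j x

  vertex⊕translate : ∀ k x → vertex k ⊕ translate 1 k x ≡ x
  vertex⊕translate zero    x = 𝟎⊕ x
  vertex⊕translate (suc i) x = ≡-pointwise λ j → ≡.trans (lookup-⊕ (e i) (shift 1 i x) j) (coordinate j)
    where
    coordinate : ∀ j → lookup (e i) j ℤ.+ lookup (shift 1 i x) j ≡ lookup x j
    coordinate j with i ≟ j
    ... | yes ≡.refl = ≡.trans (≡.cong₂ ℤ._+_ (lookup-e-≡ i) (lookup∘updateAt i x)) (u+[z-u]≡z (+ 1) (lookup x i))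
    ... | no i≢j     = ≡.trans (≡.cong₂ ℤ._+_ (lookup-e-≢ i≢j) (lookup∘updateAt′ j i (i≢j ∘ ≡.sym) x))
                               (ℤ.+-identityˡ (lookup x j))

  translate-vertex⊕ : ∀ k y → translate 1 k (vertex k ⊕ y) ≡ y
  translate-vertex⊕ zero    y = 𝟎⊕ y
  translate-vertex⊕ (suc i) y = ≡-pointwise coordinate
    where
    open ≡.≡-Reasoning
    coordinate : ∀ j → lookup (shift 1 i (e i ⊕ y)) j ≡ lookup y j
    coordinate j with i ≟ j
    ... | yes ≡.refl = begin
      lookup (shift 1 i (e i ⊕ y)) i       ≡⟨ lookup∘updateAt i (e i ⊕ y) ⟩
      lookup (e i ⊕ y) i ℤ.- + 1           ≡⟨ cong (ℤ._- + 1) (lookup-⊕ (e i) y i) ⟩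
      lookup (e i) i ℤ.+ lookup y i ℤ.- + 1 ≡⟨ cong (λ c → c ℤ.+ lookup y i ℤ.- + 1) (lookup-e-≡ i) ⟩
      + 1 ℤ.+ lookup y i ℤ.- + 1           ≡⟨ [u+z]-u≡z (+ 1) (lookup y i) ⟩
      lookup y i                           ∎
    ... | no i≢j = begin
      lookup (shift 1 i (e i ⊕ y)) j       ≡⟨ lookup∘updateAt′ j i (i≢j ∘ ≡.sym) (e i ⊕ y) ⟩
      lookup (e i ⊕ y) j                   ≡⟨ lookup-⊕ (e i) y j ⟩
      lookup (e i) j ℤ.+ lookup y j        ≡⟨ cong (ℤ._+ lookup y j) (lookup-e-≢ i≢j) ⟩
      + 0 ℤ.+ lookup y j                   ≡⟨ ℤ.+-identityˡ (lookup y j) ⟩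
      lookup y j                           ∎

  oneNonzero⇒shift : ∀ {a} {z w : Point m} → OneNonzero (z ⊖ w) (+ a) → ∃[ i ] shift a i z ≡ w
  oneNonzero⇒shift {a} {z} {w} (i , dᵢ≡a , d≡0) = i , ≡-pointwise coordinate
    where
    coordinate : ∀ j → lookup (shift a i z) j ≡ lookup w j
    coordinate j with i ≟ j
    ... | yes ≡.refl = ≡.trans (lookup∘updateAt i z) (≡.sym (lookup-⊖ z w i dᵢ≡a))
    ... | no i≢j     = ≡.trans (lookup∘updateAt′ j i (i≢j ∘ ≡.sym) z)
                         (≡.trans (≡.sym (ℤ.+-identityʳ (lookup z j))) (≡.sym (lookup-⊖ z w j (d≡0 j (i≢j ∘ ≡.sym)))))

  twoNonzero⇒shift : ∀ {a} {z w : Point m} → TwoNonzero (z ⊖ w) (+ a) (- + a) →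
                     ∃[ i ] ∃[ j ] ∃[ x ] (i ≢ j × shift a i x ≡ w × shift a j x ≡ z)
  twoNonzero⇒shift {a} {z} {w} (i , j , i≢j , dᵢ≡a , dⱼ≡-a , d≡0) =
    i , j , x , i≢j , ≡-pointwise coordinate , shiftⱼ-x≡z
    where
    open ≡.≡-Reasoning
    x = z [ j ]%= (ℤ._+ + a)
    shiftⱼ-x≡z : shift a j x ≡ z
    shiftⱼ-x≡z = ≡.trans (updateAt-updateAt-local j {h = λ c → c} z ([z+u]-u≡z (lookup z j) (+ a))) (updateAt-id j z)
    coordinate : ∀ l → lookup (shift a i x) l ≡ lookup w l
    coordinate l with i ≟ l | j ≟ l
    ... | yes ≡.refl | _ = begin
      lookup (shift a i x) i  ≡⟨ lookup∘updateAt i x ⟩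
      lookup x i ℤ.- + a      ≡⟨ cong (ℤ._- + a) (lookup∘updateAt′ i j i≢j z) ⟩
      lookup z i ℤ.- + a      ≡⟨ lookup-⊖ z w i dᵢ≡a ⟨
      lookup w i              ∎
    ... | no i≢l | yes ≡.refl = begin
      lookup (shift a i x) j       ≡⟨ lookup∘updateAt′ j i (i≢l ∘ ≡.sym) x ⟩
      lookup x j                   ≡⟨ lookup∘updateAt j z ⟩
      lookup z j ℤ.+ + a           ≡⟨ cong (λ c → lookup z j ℤ.+ c) (ℤ.neg-involutive (+ a)) ⟨
      lookup z j ℤ.- - + a         ≡⟨ lookup-⊖ z w j dⱼ≡-a ⟨
      lookup w j                   ∎
    ... | no i≢l | no j≢l = begin
      lookup (shift a i x) l       ≡⟨ lookup∘updateAt′ l i (i≢l ∘ ≡.sym) x ⟩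
      lookup x l                   ≡⟨ lookup∘updateAt′ l j (j≢l ∘ ≡.sym) z ⟩
      lookup z l                   ≡⟨ ℤ.+-identityʳ (lookup z l) ⟨
      lookup z l ℤ.- + 0           ≡⟨ lookup-⊖ z w l (d≡0 l (i≢l ∘ ≡.sym) (j≢l ∘ ≡.sym)) ⟨
      lookup w l                   ∎

  open AdditiveOperators (Point m)

  translation : ℕ → Fin (suc m) → Operator
  translation t k = record
    { apply      = λ g x → g (translate t k x)
    ; apply-cong = λ g≗h x → g≗h (translate t k x)
    ; apply-+    = λ _ _ _ → ≡.refl
    ; apply-0    = λ _ → ≡.refl
    }

  translation-^ : ∀ n t k → translation t k ^ n ≈ translation (n ℕ.* t) k
  translation-^ zero    t k g x = cong g (≡.sym (translate-0 k x))
  translation-^ (suc n) t k g x =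
    ≡.trans (translation-^ n t k g (translate t k x)) (cong g (translate-translate (n ℕ.* t) t k x))

  translation-comm : ∀ s k t l → translation s k * translation t l ≈ translation t l * translation s k
  translation-comm s k t l g x = cong g (≡.sym (translate-comm s k t l x))

  semiCrossSum : ℕ → Operator
  semiCrossSum t = sumᵒ (translation t)

  apply-semiCrossSum : ∀ t g x → apply (semiCrossSum t) g x ≡ sum (λ k → g (translate t k x))
  apply-semiCrossSum t = apply-sum (translation t)

  apply-semiCrossSum-const : ∀ t c x → apply (semiCrossSum t) (λ _ → c) x ≡ suc m ℕ.* c
  apply-semiCrossSum-const t c x = ≡.trans (apply-semiCrossSum t (λ _ → c) x) (sum-const (suc m) c)

  semiCrossSum-^-mod-prime : ∀ {p} → Prime p → ∀ t g x →
                             ∃[ c ] apply (semiCrossSum t ^ p) g x ≡ apply (semiCrossSum (p ℕ.* t)) g x ℕ.+ p ℕ.* c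
  semiCrossSum-^-mod-prime {p} pr t g x =
    let c , Aᵖ≡Σ+pc = sumᵒ-^-mod-prime (translation t) (λ k l → translation-comm t k t l) pr g x in
    c , ≡.trans Aᵖ≡Σ+pc (cong (ℕ._+ p ℕ.* c) (≡.trans (sum-cong-≗ λ k → translation-^ p t k g x)
                                                     (≡.sym (apply-semiCrossSum (p ℕ.* t) g x))))

module TilingBySemiCross {m} (L : Point m → Set) (tiling : IsTiling m (SemiCross m) L) where

  open Translations m
  open AdditiveOperators (Point m)

  translate-unique : ∀ {x k l} → L (translate 1 k x) → L (translate 1 l x) → k ≡ l
  translate-unique {x} {k} {l} Lk Ll = vertex-injective (proj₁ (proj₂ tiling x
    (vertex k) (translate 1 k x) (vertex l) (translate 1 l x)
    (vertex∈semiCross k) Lk (≡.sym (vertex⊕translate k x))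
    (vertex∈semiCross l) Ll (≡.sym (vertex⊕translate l x))))

  translate-covers : ∀ x → ∃[ k ] L (translate 1 k x)
  translate-covers x with proj₁ tiling x
  ... | v , l , v∈V , Ll , x≡v⊕l with semiCross⇒vertex v∈V
  ... | k , ≡.refl = k , subst L (≡.sym (≡.trans (cong (translate 1 k) x≡v⊕l) (translate-vertex⊕ k l))) Ll

  L? : Decidable L
  L? y with translate-covers y
  ... | zero  , Ly = yes Ly
  ... | suc i , Lk = no λ Ly → 0≢1+n (translate-unique Ly Lk)

  indicator : Point m → ℕ
  indicator y = if does (L? y) then 1 else 0

  indicator-∈ : ∀ {y} → L y → indicator y ≡ 1
  indicator-∈ {y} Ly = cong (if_then 1 else 0) (dec-true (L? y) Ly)

  indicator-∉ : ∀ {y} → ¬ L y → indicator y ≡ 0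
  indicator-∉ {y} ¬Ly = cong (if_then 1 else 0) (dec-false (L? y) ¬Ly)

  -- The translates of the dilate t V_m by L tile ℤ^m: every x is x = t v + l in exactly one way.
  DilatedTiling : ℕ → Set
  DilatedTiling t = ∀ x → apply (semiCrossSum t) indicator x ≡ 1

  dilatedTiling-1 : DilatedTiling 1
  dilatedTiling-1 x = let k , Lk = translate-covers x in
    ≡.trans (apply-semiCrossSum 1 indicator x)
      (single-one⇒sum≡1 _ k (indicator-∈ Lk) λ l l≢k → indicator-∉ λ Ll → l≢k (translate-unique Ll Lk))

  dilatedTiling-unique : ∀ {t} → DilatedTiling t → ∀ {x k l} → L (translate t k x) → L (translate t l x) → k ≡ l
  dilatedTiling-unique {t} tiles {x} {k} {l} Lk Ll with k ≟ l
  ... | yes k≡l = k≡l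
  ... | no k≢l  = contradiction 2≤1 λ { (s≤s ()) }
    where
    open ℕ.≤-Reasoning
    2≤1 : 2 ≤ 1
    2≤1 = begin
      2                                                            ≡⟨ ≡.cong₂ ℕ._+_ (indicator-∈ Lk) (indicator-∈ Ll) ⟨
      indicator (translate t k x) ℕ.+ indicator (translate t l x)  ≤⟨ +-≤-sum (λ j → indicator (translate t j x)) k≢l ⟩
      sum (λ j → indicator (translate t j x))                      ≡⟨ apply-semiCrossSum t indicator x ⟨
      apply (semiCrossSum t) indicator x                           ≡⟨ tiles x ⟩
      1                                                            ∎

  dilatedTiling-^ : ∀ {t} → DilatedTiling t → ∀ n y → apply (semiCrossSum t ^ suc n) indicator y ≡ suc m ℕ.^ n
  dilatedTiling-^     tiles zero    y = tiles y
  dilatedTiling-^ {t} tiles (suc n) y =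
    ≡.trans (apply-cong (semiCrossSum t) (dilatedTiling-^ tiles n) y) (apply-semiCrossSum-const t _ y)

  dilate-prime : ∀ {t p} → DilatedTiling t → Prime p → ¬ p ∣ suc m → DilatedTiling (p ℕ.* t)
  dilate-prime {t} {suc p′} tiles pr p∤1+m x =
    sum≡length⇒≡1 (λ k → G (translate 1 k x)) (λ k → G-positive (translate 1 k x)) G-sum zero
    where
    p = suc p′
    G : Point m → ℕ
    G = apply (semiCrossSum (p ℕ.* t)) indicator

    G-positive : ∀ y → 1 ≤ G y
    G-positive y = let c , Aᵖ≡G+pc = semiCrossSum-^-mod-prime pr t indicator y in
      ℕ.n≢0⇒n>0 λ Gy≡0 → p∤1+m (prime∣^⇒∣ p′ pr (divides c (begin
        suc m ℕ.^ p′                            ≡⟨ dilatedTiling-^ tiles p′ y ⟨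
        apply (semiCrossSum t ^ p) indicator y  ≡⟨ Aᵖ≡G+pc ⟩
        G y ℕ.+ p ℕ.* c                         ≡⟨ cong (ℕ._+ p ℕ.* c) Gy≡0 ⟩
        p ℕ.* c                                 ≡⟨ ℕ.*-comm p c ⟩
        c ℕ.* p                                 ∎)))
      where open ≡.≡-Reasoning

    G-sum : sum (λ k → G (translate 1 k x)) ≡ suc m
    G-sum = begin
      sum (λ k → G (translate 1 k x))
        ≡⟨ sum-cong-≗ (λ k → apply-semiCrossSum (p ℕ.* t) indicator (translate 1 k x)) ⟩
      sum (λ k → sum (λ l → indicator (translate (p ℕ.* t) l (translate 1 k x))))
        ≡⟨ ∑-comm (λ k l → indicator (translate (p ℕ.* t) l (translate 1 k x))) ⟩
      sum (λ l → sum (λ k → indicator (translate (p ℕ.* t) l (translate 1 k x))))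
        ≡⟨ sum-cong-≗ (λ l → sum-cong-≗ λ k → cong indicator (translate-comm (p ℕ.* t) l 1 k x)) ⟩
      sum (λ l → sum (λ k → indicator (translate 1 k (translate (p ℕ.* t) l x))))
        ≡⟨ sum-cong-≗ (λ l → ≡.trans (≡.sym (apply-semiCrossSum 1 indicator (translate (p ℕ.* t) l x)))
                                     (dilatedTiling-1 (translate (p ℕ.* t) l x))) ⟩
      sum {suc m} (λ _ → 1)
        ≡⟨ sum-const (suc m) 1 ⟩
      suc m ℕ.* 1
        ≡⟨ ℕ.*-identityʳ (suc m) ⟩
      suc m
        ∎
      where open ≡.≡-Reasoning

  dilate-primes : ∀ {t} → DilatedTiling t → Prime (suc m) →
                  ∀ {ps} → All Prime ps → product ps < suc m → DilatedTiling (product ps ℕ.* t)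
  dilate-primes {t} tiles q-prime []       _ = subst DilatedTiling (≡.sym (ℕ.*-identityˡ t)) tiles
  dilate-primes {t} tiles q-prime {p ∷ ps} (p-prime ∷ ps-prime) Π<q =
    subst DilatedTiling (≡.sym (ℕ.*-assoc p (product ps) t))
      (dilate-prime (dilate-primes tiles q-prime ps-prime Πps<q) p-prime (prime∤prime p-prime q-prime p<q))
    where
    instance
      _ = productOfPrimes≢0 ps-prime
      _ = prime⇒nonZero p-prime
    p<q : p < suc m
    p<q = ℕ.≤-<-trans (ℕ.m≤m*n p (product ps)) Π<q
    Πps<q : product ps < suc m
    Πps<q = ℕ.≤-<-trans (ℕ.m≤n*m (product ps) p) Π<q

  dilatedTiling-≤m : Prime (suc m) → ∀ {a} → 1 ≤ a → a ≤ m → DilatedTiling a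
  dilatedTiling-≤m q-prime {a} 1≤a a≤m =
    subst DilatedTiling (≡.trans (ℕ.*-identityʳ _) (≡.sym isFactorisation))
      (dilate-primes dilatedTiling-1 q-prime factorsPrime (subst (_< suc m) isFactorisation (s≤s a≤m)))
    where open PrimeFactorisation (factorise a {{ℕ.>-nonZero 1≤a}})

  ¬OneNonzero-⊖ : Prime (suc m) → ∀ {a} → 1 ≤ a → a ≤ m →
                  ∀ {z w} → L z → L w → ¬ OneNonzero (z ⊖ w) (+ a)
  ¬OneNonzero-⊖ q-prime 1≤a a≤m Lz Lw d =
    let i , shiftᵢ-z≡w = oneNonzero⇒shift d in
    0≢1+n (dilatedTiling-unique (dilatedTiling-≤m q-prime 1≤a a≤m)
             {k = zero} {l = suc i} Lz (subst L (≡.sym shiftᵢ-z≡w) Lw))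

  ¬TwoNonzero-⊖ : Prime (suc m) → ∀ {a} → 1 ≤ a → a ≤ m →
                  ∀ {z w} → L z → L w → ¬ TwoNonzero (z ⊖ w) (+ a) (- + a)
  ¬TwoNonzero-⊖ q-prime 1≤a a≤m Lz Lw d =
    let i , j , x , i≢j , shiftᵢ-x≡w , shiftⱼ-x≡z = twoNonzero⇒shift d in
    i≢j (suc-injective (dilatedTiling-unique (dilatedTiling-≤m q-prime 1≤a a≤m)
                         {k = suc i} {l = suc j} (subst L (≡.sym shiftᵢ-x≡w) Lw) (subst L (≡.sym shiftⱼ-x≡z) Lz)))

corollary29 : (q : ℕ) → Prime q → (L : Point (q ∸ 1) → Set) →
    IsTiling (q ∸ 1) (SemiCross (q ∸ 1)) L →
    (W : Point (q ∸ 1)) → L W → (a : ℕ) → 1 ≤ a → a ≤ q ∸ 1 →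
    (¬ (∃[ Z ] (L Z × OneNonzero (Z ⊖ W) (+ a)))) ×
    (¬ (∃[ Z ] (L Z × TwoNonzero (Z ⊖ W) (+ a) (- (+ a)))))
corollary29 (suc m) q-prime L tiling W LW a 1≤a a≤m =
  (λ (Z , LZ , d) → ¬OneNonzero-⊖ q-prime 1≤a a≤m LZ LW d) ,
  (λ (Z , LZ , d) → ¬TwoNonzero-⊖ q-prime 1≤a a≤m LZ LW d)
  where open TilingBySemiCross L tiling
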